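{- The following hold for positive integers $n$: $g(n,5,1)=\frac59 n$ if $9\mid n$; $g(n,5,2)=\lceil\frac{9}{10}n\rceil$; $g(n,5,s)=n$ for all $s\ge3$; $g(n,6,1)=\frac12 n$ if $4\mid n$; $g(n,6,2)=\frac45 n$ if $10\mid n$; $g(n,6,s)=n$ for all $s\ge3$; $g(n,7,1)=\frac37 n$ if $7\mid n$; $g(n,7,2)=\frac57 n$ if $7\mid n$; $g(n,7,3)=\lceil\frac{34}{35}n\rceil$; $g(n,7,s)=n$ for all $s>3$.
   Context: An $r$-edge colouring of $K_n$ assigns to each edge one of $r$ colours. $g(n,r,s)$ denotes the largest integer $m$ such that in every $r$-edge colouring of $K_n$ there is a set $S$ of at most $s$ colours such that at least $m$ vertices of $K_n$ are incident to at least one edge whose colour lies in $S$. -}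

module Defs where

open import Data.Nat using (ℕ; suc; _≤_; _+_; _*_)
open import Data.Nat.DivMod using (_/_)
open import Data.Fin using (Fin)
open import Data.Fin.Subset using (Subset; _∈_; ∣_∣)
open import Data.Product using (Σ; ∃; _×_; _,_; proj₁)
open import Relation.Binary.PropositionalEquality using (_≡_; _≢_)

-- An r-edge colouring of K_n: a colour in Fin r for every pair of
-- vertices, symmetric; the diagonal values are irrelevant (no loops).
Colouring : ℕ → ℕ → Set
Colouring n r = Σ (Fin n → Fin n → Fin r) (λ c → ∀ i j → c i j ≡ c j i)

Incident : ∀ {n r} → Colouring n r → Subset r → Fin n → Set
Incident c S v = ∃ λ u → u ≢ v × proj₁ c v u ∈ S

CoversAtLeast : ∀ {n r} → Colouring n r → Subset r → ℕ → Set
CoversAtLeast {n} c S m =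
  Σ (Subset n) λ T → m ≤ ∣ T ∣ × (∀ v → v ∈ T → Incident c S v)

GoodBound : ℕ → ℕ → ℕ → ℕ → Set
GoodBound n r s m =
  (c : Colouring n r) → Σ (Subset r) λ S → ∣ S ∣ ≤ s × CoversAtLeast c S m

IsG : ℕ → ℕ → ℕ → ℕ → Set
IsG n r s m = GoodBound n r s m × (∀ m′ → GoodBound n r s m′ → m′ ≤ m)

-- ⌈ a * n / b ⌉ for b = suc b'
ceilFrac : ℕ → ℕ → ℕ → ℕ
ceilFrac a b' n = (a * n + b') / suc b'

-- Two vertices share the colour of the edge between them, so the colour sets of
-- the vertices of any colouring form an intersecting family. If sets of at most s colours
-- carry weights of total W such that every vertex colour set meets sets of weight at least α,
-- one of them meets the colour sets of at least ⌈αn/W⌉ vertices. The weighting is chosen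
-- adaptively: whenever some vertex colour set is met with weight below α it is revealed and the
-- weighting revised, and a finite search over all possible revelations shows that this process
-- always ends with a weighting that serves every vertex.
--
-- Give the vertices colour sets ("types") periodically from a pairwise
-- intersecting list and colour each edge by the first colour common to the types of its ends.
-- A vertex is then incident to a colour of S only if its type meets S, and a finite check over
-- all S with at most s colours bounds the proportion of such vertices.

module Submission where

open import Defs
open import Data.Bool.Base using (Bool; true; false; T; not; _∧_; _∨_; if_then_else_)
open import Data.Bool.ListAction using (all)
open import Data.Bool.Properties using (T-∧; T-∨; T-≡)
open import Data.Fin.Base using (Fin; zero; suc; toℕ)
open import Data.Fin.Properties using (_≟_; all?; any?; ¬∀⟶∃¬; punchInᵢ≢i)
open import Data.Fin.Subset
  using (Subset; _∈_; ∣_∣; inside; outside; ⁅_⁆; ⋃; ⋂; _─_) renaming (⊥ to ∅)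
open import Data.Fin.Subset.Properties using (p⊆q⇒∣p∣≤∣q∣; ∣p∣≤n)
open import Data.List.Base as List using (List; []; _∷_; length; filterᵇ)
open import Data.List.Extrema.Nat using (argmax; argmax-all; f[⊥]≤f[argmax]; f[xs]≤f[argmax])
open import Data.List.Relation.Unary.All as All using (All; []; _∷_)
open import Data.List.Relation.Unary.All.Properties using (all⁺; all⁻)
open import Data.Nat.Base
  using (ℕ; zero; suc; _+_; _*_; _∸_; _≤_; _<_; _≤ᵇ_; _<ᵇ_; _≡ᵇ_; z≤n; s≤s; s≤s⁻¹; z<s; s<s
        ; NonZero)
open import Data.Nat.DivMod
  using (_/_; _%_; m<n*o⇒m/o<n; m*n/n≡m; /-monoˡ-≤; m<n⇒m%n≡m; m%n<n; m≡m%n+[m/n]*n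
        ; [m+n]%n≡m%n)
open import Data.Nat.Properties hiding (_≟_)
open import Data.Nat.Solver using (module +-*-Solver)
open import Data.Product.Base using (∃; _×_; _,_; proj₁; proj₂)
open import Data.Sum.Base using (inj₂)
open import Data.Vec.Base
  using (Vec; []; _∷_; _∷ʳ_; here; there; tabulate; lookup; toList; map; replicate; zipWith)
open import Data.Vec.Properties using (lookup∘tabulate; []=⇒lookup; lookup⇒[]=)
open import Function.Base using (_∘_)
open import Function.Bundles using (Equivalence)
open import Relation.Nullary.Decidable using (yes; no; ⌊_⌋; ¬?; _×-dec_; toWitness; fromWitness)
open import Relation.Nullary.Negation using (contradiction)
open import Relation.Binary.PropositionalEquality
  using (_≡_; _≢_; refl; sym; trans; cong; cong₂; subst; module ≡-Reasoning)

open import Algebra.Properties.Semiring.Sum +-*-semiring using (sum; ∑-distrib-+; *-distribˡ-sum)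
open +-*-Solver using (solve; _:+_; _:=_)

meets : ∀ {r} → Subset r → Subset r → Bool
meets [] [] = false
meets (a ∷ A) (b ∷ B) = (a ∧ b) ∨ meets A B

firstCommon : ∀ {r} (A B : Subset r) → T (meets A B) → Fin r
firstCommon [] [] ()
firstCommon (true ∷ A) (true ∷ B) _ = zero
firstCommon (true ∷ A) (false ∷ B) p = suc (firstCommon A B p)
firstCommon (false ∷ A) (b ∷ B) p = suc (firstCommon A B p)

firstCommon∈ˡ : ∀ {r} (A B : Subset r) p → firstCommon A B p ∈ A
firstCommon∈ˡ [] [] ()
firstCommon∈ˡ (true ∷ A) (true ∷ B) _ = here
firstCommon∈ˡ (true ∷ A) (false ∷ B) p = there (firstCommon∈ˡ A B p)
firstCommon∈ˡ (false ∷ A) (b ∷ B) p = there (firstCommon∈ˡ A B p)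

firstCommon∈ʳ : ∀ {r} (A B : Subset r) p → firstCommon A B p ∈ B
firstCommon∈ʳ [] [] ()
firstCommon∈ʳ (true ∷ A) (true ∷ B) _ = here
firstCommon∈ʳ (true ∷ A) (false ∷ B) p = there (firstCommon∈ʳ A B p)
firstCommon∈ʳ (false ∷ A) (b ∷ B) p = there (firstCommon∈ʳ A B p)

firstCommon-comm : ∀ {r} (A B : Subset r) p q → firstCommon A B p ≡ firstCommon B A q
firstCommon-comm [] [] ()
firstCommon-comm (true ∷ A) (true ∷ B) _ _ = refl
firstCommon-comm (true ∷ A) (false ∷ B) p q = cong suc (firstCommon-comm A B p q)
firstCommon-comm (false ∷ A) (true ∷ B) p q = cong suc (firstCommon-comm A B p q)
firstCommon-comm (false ∷ A) (false ∷ B) p q = cong suc (firstCommon-comm A B p q)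

meets-intro : ∀ {r} {A B : Subset r} {i} → i ∈ A → i ∈ B → T (meets A B)
meets-intro here here = _
meets-intro {A = a ∷ _} {b ∷ _} (there i∈A) (there i∈B) =
  Equivalence.from T-∨ (inj₂ (meets-intro i∈A i∈B))

∈tabulate⁺ : ∀ {n} {f : Fin n → Bool} {i} → T (f i) → i ∈ tabulate f
∈tabulate⁺ {f = f} {i} fi =
  lookup⇒[]= i (tabulate f) (trans (lookup∘tabulate f i) (Equivalence.to T-≡ fi))

∈tabulate⁻ : ∀ {n} {f : Fin n → Bool} {i} → i ∈ tabulate f → T (f i)
∈tabulate⁻ {f = f} {i} i∈ =
  Equivalence.from T-≡ (trans (sym (lookup∘tabulate f i)) ([]=⇒lookup i∈))

allSubsets : ∀ r → (Subset r → Bool) → Bool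
allSubsets zero P = P []
allSubsets (suc r) P = allSubsets r (P ∘ (true ∷_)) ∧ allSubsets r (P ∘ (false ∷_))

allSubsets-sound : ∀ r {P : Subset r → Bool} → T (allSubsets r P) → ∀ S → T (P S)
allSubsets-sound zero all-P [] = all-P
allSubsets-sound (suc r) {P} all-P (true ∷ S) =
  allSubsets-sound r (proj₁ (Equivalence.to (T-∧ {allSubsets r (P ∘ (true ∷_))}) all-P)) S
allSubsets-sound (suc r) {P} all-P (false ∷ S) =
  allSubsets-sound r (proj₂ (Equivalence.to (T-∧ {allSubsets r (P ∘ (true ∷_))}) all-P)) S

infixr 5 _⇒ᵇ_
_⇒ᵇ_ : Bool → Bool → Bool
true ⇒ᵇ b = b
false ⇒ᵇ _ = true

⇒ᵇ-elim : ∀ {a b} → T (a ⇒ᵇ b) → T a → T b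
⇒ᵇ-elim {true} b _ = b

forSmall : ∀ r → ℕ → (Subset r → Bool) → Bool
forSmall r s P = allSubsets r (λ S → (∣ S ∣ ≤ᵇ s) ⇒ᵇ P S)

forSmall-sound : ∀ r s {P} → T (forSmall r s P) → ∀ S → ∣ S ∣ ≤ s → T (P S)
forSmall-sound r s all-P S ∣S∣≤s = ⇒ᵇ-elim (allSubsets-sound r all-P S) (≤⇒≤ᵇ ∣S∣≤s)

allBelow : ℕ → (ℕ → Bool) → Bool
allBelow zero f = true
allBelow (suc n) f = f 0 ∧ allBelow n (f ∘ suc)

allBelow-sound : ∀ n {f} → T (allBelow n f) → ∀ {i} → i < n → T (f i)
allBelow-sound (suc n) {f} all-f {zero} _ = proj₁ (Equivalence.to (T-∧ {f 0}) all-f)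
allBelow-sound (suc n) {f} all-f {suc i} (s≤s i<n) =
  allBelow-sound n (proj₂ (Equivalence.to (T-∧ {f 0}) all-f)) i<n

fromBool : Bool → ℕ
fromBool true = 1
fromBool false = 0

count : ∀ {n} → (Fin n → Bool) → ℕ
count f = sum (fromBool ∘ f)

∣tabulate∣≡count : ∀ {n} (f : Fin n → Bool) → ∣ tabulate f ∣ ≡ count f
∣tabulate∣≡count {zero} f = refl
∣tabulate∣≡count {suc n} f with f zero
... | true = cong suc (∣tabulate∣≡count (f ∘ suc))
... | false = ∣tabulate∣≡count (f ∘ suc)

∣p∣≤count : ∀ {n} (p : Subset n) (f : Fin n → Bool) →
            (∀ {v} → v ∈ p → T (f v)) → ∣ p ∣ ≤ count f
∣p∣≤count p f p⊆f = ≤-trans (p⊆q⇒∣p∣≤∣q∣ (∈tabulate⁺ ∘ p⊆f)) (≤-reflexive (∣tabulate∣≡count f))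

sum-const : ∀ {n} a → sum {n} (λ _ → a) ≡ n * a
sum-const {zero} a = refl
sum-const {suc n} a = cong (a +_) (sum-const {n} a)

sum-mono-≤ : ∀ {n} {f g : Fin n → ℕ} → (∀ i → f i ≤ g i) → sum f ≤ sum g
sum-mono-≤ {zero} f≤g = z≤n
sum-mono-≤ {suc n} f≤g = +-mono-≤ (f≤g zero) (sum-mono-≤ (f≤g ∘ suc))

countBelow : ℕ → (ℕ → Bool) → ℕ
countBelow zero f = 0
countBelow (suc n) f = fromBool (f 0) + countBelow n (f ∘ suc)

count-toℕ : ∀ {n} (f : ℕ → Bool) → count {n} (f ∘ toℕ) ≡ countBelow n f
count-toℕ {zero} f = refl
count-toℕ {suc n} f = cong (fromBool (f 0) +_) (count-toℕ {n} (f ∘ suc))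

countBelow-cong : ∀ n {f g : ℕ → Bool} → (∀ {i} → i < n → f i ≡ g i) →
                  countBelow n f ≡ countBelow n g
countBelow-cong zero f≡g = refl
countBelow-cong (suc n) f≡g = cong₂ _+_ (cong fromBool (f≡g z<s)) (countBelow-cong n (f≡g ∘ s<s))

countBelow-+ : ∀ a b f → countBelow (a + b) f ≡ countBelow a f + countBelow b (λ i → f (a + i))
countBelow-+ zero b f = refl
countBelow-+ (suc a) b f =
  trans (cong (fromBool (f 0) +_) (countBelow-+ a b (f ∘ suc))) (sym (+-assoc (fromBool (f 0)) _ _))

countBelow-not : ∀ n f → countBelow n f + countBelow n (not ∘ f) ≡ n
countBelow-not zero f = refl
countBelow-not (suc n) f with f 0
... | true = cong suc (countBelow-not n (f ∘ suc))
... | false = trans (+-suc (countBelow n (f ∘ suc)) _) (cong suc (countBelow-not n (f ∘ suc)))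

-- Lower bounds: adaptive weightings
Weighting : ℕ → Set
Weighting r = List (ℕ × Subset r)

weight : ∀ {r} → Weighting r → ℕ
weight [] = 0
weight ((w , _) ∷ P) = w + weight P

score : ∀ {r} → Weighting r → Subset r → ℕ
score [] A = 0
score ((w , S) ∷ P) A = w * fromBool (meets A S) + score P A

module Averaging {n r} (C : Fin n → Subset r) where

  coverage : Subset r → ℕ
  coverage S = count (λ v → meets (C v) S)

  weightedCoverage : Weighting r → ℕ
  weightedCoverage [] = 0
  weightedCoverage ((w , S) ∷ P) = w * coverage S + weightedCoverage P

  sum-score≡weightedCoverage : ∀ P → sum (λ v → score P (C v)) ≡ weightedCoverage P
  sum-score≡weightedCoverage [] = trans (sum-const {n} 0) (*-zeroʳ n)
  sum-score≡weightedCoverage ((w , S) ∷ P) = begin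
    sum (λ v → w * fromBool (meets (C v) S) + score P (C v))
      ≡⟨ ∑-distrib-+ (λ v → w * fromBool (meets (C v) S)) (λ v → score P (C v)) ⟩
    sum (λ v → w * fromBool (meets (C v) S)) + sum (λ v → score P (C v))
      ≡⟨ cong₂ _+_ (sym (*-distribˡ-sum w (fromBool ∘ λ v → meets (C v) S)))
                   (sum-score≡weightedCoverage P) ⟩
    w * coverage S + weightedCoverage P ∎
    where open ≡-Reasoning

  weightedCoverage≤ : ∀ P M → All (λ p → coverage (proj₂ p) ≤ M) P →
                      weightedCoverage P ≤ weight P * M
  weightedCoverage≤ [] M [] = z≤n
  weightedCoverage≤ ((w , S) ∷ P) M (S≤M ∷ P≤M) = begin
    w * coverage S + weightedCoverage P ≤⟨ +-mono-≤ (*-monoʳ-≤ w S≤M) (weightedCoverage≤ P M P≤M) ⟩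
    w * M + weight P * M                ≡⟨ sym (*-distribʳ-+ M w (weight P)) ⟩
    (w + weight P) * M                  ∎
    where open ≤-Reasoning

  best : ℕ × Subset r → Weighting r → ℕ × Subset r
  best = argmax (coverage ∘ proj₂)

  averaging : ∀ {α} p P → (∀ v → α ≤ score (p ∷ P) (C v)) →
              α * n ≤ weight (p ∷ P) * coverage (proj₂ (best p P))
  averaging {α} p P α≤score = begin
    α * n                                     ≡⟨ *-comm α n ⟩
    n * α                                     ≡⟨ sum-const {n} α ⟨
    sum {n} (λ _ → α)                         ≤⟨ sum-mono-≤ α≤score ⟩
    sum (λ v → score (p ∷ P) (C v))           ≡⟨ sum-score≡weightedCoverage (p ∷ P) ⟩
    weightedCoverage (p ∷ P)                  ≤⟨ weightedCoverage≤ (p ∷ P) _ best-maximal ⟩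
    weight (p ∷ P) * coverage (proj₂ (best p P)) ∎
    where
    open ≤-Reasoning
    best-maximal : All (λ q → coverage (proj₂ q) ≤ coverage (proj₂ (best p P))) (p ∷ P)
    best-maximal =
      f[⊥]≤f[argmax] {f = coverage ∘ proj₂} p P ∷ f[xs]≤f[argmax] {f = coverage ∘ proj₂} p P

Strategy : ℕ → Set
Strategy r = List (Subset r) → Weighting r

module CoveringGame {r} (s W α : ℕ) (σ : Strategy r) where

  admissible : Weighting r → Bool
  admissible P = (weight P ≤ᵇ W) ∧ all (λ p → ∣ proj₂ p ∣ ≤ᵇ s) P

  admissible-sound : ∀ P → T (admissible P) → weight P ≤ W × All (λ q → ∣ proj₂ q ∣ ≤ s) P
  admissible-sound P adm with Equivalence.to (T-∧ {weight P ≤ᵇ W}) adm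
  ... | light , small =
    ≤ᵇ⇒≤ _ _ light , All.map (≤ᵇ⇒≤ _ _) (all⁺ (λ q → ∣ proj₂ q ∣ ≤ᵇ s) P small)

  threat : List (Subset r) → Subset r → Bool
  threat seen A = (score (σ seen) A <ᵇ α) ∧ meets A A ∧ all (meets A) seen

  wins : ℕ → List (Subset r) → Bool
  wins zero _ = false
  wins (suc f) seen =
    admissible (σ seen) ∧ allSubsets r (λ A → threat seen A ⇒ᵇ wins f (A ∷ seen))

  wins-suc : ∀ f {seen} → T (wins (suc f) seen) →
             T (admissible (σ seen)) × (∀ A → T (threat seen A) → T (wins f (A ∷ seen)))
  wins-suc f {seen} w with Equivalence.to (T-∧ {admissible (σ seen)}) w
  ... | adm , respond = adm , λ A → ⇒ᵇ-elim (allSubsets-sound r respond A)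

  module _ {n} (C : Fin (suc n) → Subset r)
           (C-intersecting : ∀ u v → T (meets (C u) (C v))) where
    open Averaging C

    Cover : Set
    Cover = ∃ λ S → ∣ S ∣ ≤ s × α * suc n ≤ W * coverage S

    admissible⇒cover : ∀ P → T (admissible P) → (∀ v → α ≤ score P (C v)) → 0 < α → Cover
    admissible⇒cover [] _ α≤score 0<α = contradiction (α≤score zero) (<⇒≱ 0<α)
    admissible⇒cover (p ∷ P) adm α≤score _ with admissible-sound (p ∷ P) adm
    ... | light , small-p ∷ small-P =
      proj₂ (best p P) ,
      argmax-all (coverage ∘ proj₂) {P = λ q → ∣ proj₂ q ∣ ≤ s} small-p small-P ,
      ≤-trans (averaging p P α≤score) (*-monoˡ-≤ _ light)

    play : ∀ f seen → All (λ B → ∀ v → T (meets (C v) B)) seen → T (wins f seen) → 0 < α → Cover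
    play (suc f) seen seen-met w 0<α with wins-suc f w | all? (λ v → α ≤? score (σ seen) (C v))
    ... | adm , _ | yes all-good = admissible⇒cover (σ seen) adm all-good 0<α
    ... | _ , respond | no some-bad with ¬∀⟶∃¬ (suc n) _ (λ v → α ≤? score (σ seen) (C v)) some-bad
    ...   | v , bad =
      play f (C v ∷ seen) ((λ u → C-intersecting u v) ∷ seen-met) (respond (C v) is-threat) 0<α
      where
      meets-seen : T (all (meets (C v)) seen)
      meets-seen = all⁻ (meets (C v)) (All.map (λ B-met → B-met v) seen-met)
      is-threat : T (threat seen (C v))
      is-threat = Equivalence.from (T-∧ {score (σ seen) (C v) <ᵇ α}) (<⇒<ᵇ (≰⇒> bad) ,
        Equivalence.from (T-∧ {meets (C v) (C v)}) (C-intersecting v v , meets-seen))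

module Profile {n r} (c : Colouring n r) where

  colour : Fin n → Fin n → Fin r
  colour = proj₁ c

  coloursAt : Fin n → Subset r
  coloursAt v = tabulate (λ i → ⌊ any? (λ u → ¬? (u ≟ v) ×-dec (colour v u ≟ i)) ⌋)

  coloursAt⁺ : ∀ {u v} → u ≢ v → colour v u ∈ coloursAt v
  coloursAt⁺ {u} u≢v = ∈tabulate⁺ (fromWitness (u , u≢v , refl))

  coloursAt⁻ : ∀ {v i} → i ∈ coloursAt v → ∃ λ u → u ≢ v × colour v u ≡ i
  coloursAt⁻ i∈ = toWitness (∈tabulate⁻ i∈)

  open Averaging coloursAt

  covers : ∀ S {m} → m ≤ coverage S → CoversAtLeast c S m
  covers S m≤ = tabulate (λ v → meets (coloursAt v) S) ,
                ≤-trans m≤ (≤-reflexive (sym (∣tabulate∣≡count (λ v → meets (coloursAt v) S)))) ,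
                λ v v∈ → incident v (∈tabulate⁻ v∈)
    where
    incident : ∀ v → T (meets (coloursAt v) S) → Incident c S v
    incident v meet with coloursAt⁻ (firstCommon∈ˡ _ _ meet)
    ... | u , u≢v , colour≡ = u , u≢v , subst (_∈ S) (sym colour≡) (firstCommon∈ʳ _ _ meet)

module _ {n r} (c : Colouring (suc (suc n)) r) where
  open Profile c

  coloursAt-intersecting : ∀ u v → T (meets (coloursAt u) (coloursAt v))
  coloursAt-intersecting u v with u ≟ v
  ... | no u≢v =
    meets-intro (coloursAt⁺ (u≢v ∘ sym)) (subst (_∈ coloursAt v) (proj₂ c v u) (coloursAt⁺ u≢v))
  ... | yes refl = meets-intro (coloursAt⁺ (punchInᵢ≢i u zero)) (coloursAt⁺ (punchInᵢ≢i u zero))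

-- m ≤ ⌈a / b⌉, phrased without division
infix 4 _≤⌈_÷_⌉
_≤⌈_÷_⌉ : ℕ → ℕ → ℕ → Set
m ≤⌈ a ÷ b ⌉ = ∀ x → a ≤ b * x → m ≤ x

ceilFrac-≤⌈⌉ : ∀ a c n → ceilFrac a c n ≤⌈ a * n ÷ suc c ⌉
ceilFrac-≤⌈⌉ a c n x a*n≤ = s≤s⁻¹ (m<n*o⇒m/o<n (begin-strict
  a * n + c         ≤⟨ +-monoˡ-≤ c a*n≤ ⟩
  suc c * x + c     <⟨ n<1+n _ ⟩
  suc (suc c * x + c) ≡⟨ cong suc (trans (+-comm (suc c * x) c) (cong (c +_) (*-comm (suc c) x))) ⟩
  suc x * suc c     ∎))
  where open ≤-Reasoning

≤⌈⌉-exact : ∀ {m a b} .{{_ : NonZero b}} → m * b ≡ a → m ≤⌈ a ÷ b ⌉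
≤⌈⌉-exact {m} {a} {b} m*b≡a x a≤b*x =
  *-cancelˡ-≤ b (subst (_≤ b * x) (trans (sym m*b≡a) (*-comm m b)) a≤b*x)

≤⌈⌉-scaled : ∀ m₀ α K W .{{_ : NonZero W}} → m₀ * W ≡ α * K →
             (k : ℕ) → m₀ * k ≤⌈ α * (K * k) ÷ W ⌉
≤⌈⌉-scaled m₀ α K W m₀*W≡α*K k = ≤⌈⌉-exact (begin
  m₀ * k * W   ≡⟨ *-assoc m₀ k W ⟩
  m₀ * (k * W) ≡⟨ cong (m₀ *_) (*-comm k W) ⟩
  m₀ * (W * k) ≡⟨ *-assoc m₀ W k ⟨
  m₀ * W * k   ≡⟨ cong (_* k) m₀*W≡α*K ⟩
  α * K * k    ≡⟨ *-assoc α K k ⟩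
  α * (K * k)  ∎)
  where open ≡-Reasoning

winning⇒GoodBound : ∀ {r s W α n m} (σ : Strategy r) fuel →
                    T (CoveringGame.wins s W α σ fuel []) →
                    0 < α → 2 ≤ n → m ≤⌈ α * n ÷ W ⌉ → GoodBound n r s m
winning⇒GoodBound {r} {s} {W} {α} {suc (suc n)} σ fuel w 0<α (s≤s (s≤s _)) m≤⌈⌉ c =
  let S , ∣S∣≤s , α*n≤ = play coloursAt (coloursAt-intersecting c) fuel [] [] w 0<α
  in  S , ∣S∣≤s , covers S (m≤⌈⌉ _ α*n≤)
  where
  open Profile c
  open CoveringGame s W α σ

-- Upper bounds: periodic colourings
module Cyclic (K : ℕ) .{{_ : NonZero K}} where

  countBelow-periodic : ∀ q h → countBelow (q * K) (h ∘ (_% K)) ≡ q * countBelow K h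
  countBelow-periodic zero h = refl
  countBelow-periodic (suc q) h = begin
    countBelow (K + q * K) (h ∘ (_% K))
      ≡⟨ countBelow-+ K (q * K) (h ∘ (_% K)) ⟩
    countBelow K (h ∘ (_% K)) + countBelow (q * K) (λ i → h ((K + i) % K))
      ≡⟨ cong₂ _+_ (countBelow-cong K (cong h ∘ m<n⇒m%n≡m))
                   (countBelow-cong (q * K) (λ {i} _ → cong h (shift i))) ⟩
    countBelow K h + countBelow (q * K) (h ∘ (_% K))
      ≡⟨ cong (countBelow K h +_) (countBelow-periodic q h) ⟩
    countBelow K h + q * countBelow K h ∎
    where
    open ≡-Reasoning
    shift : ∀ i → (K + i) % K ≡ i % K
    shift i = trans (cong (_% K) (+-comm K i)) ([m+n]%n≡m%n i K)

  n/K≤countBelow : ∀ n h → 1 ≤ countBelow K h → n / K ≤ countBelow n (h ∘ (_% K))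
  n/K≤countBelow n h 1≤ = begin
    q                                    ≡⟨ *-identityʳ q ⟨
    q * 1                                ≤⟨ *-monoʳ-≤ q 1≤ ⟩
    q * countBelow K h                   ≡⟨ countBelow-periodic q h ⟨
    countBelow (q * K) f                 ≤⟨ m≤m+n _ _ ⟩
    countBelow (q * K) f + countBelow (n % K) (λ i → f (q * K + i))
                                         ≡⟨ countBelow-+ (q * K) (n % K) f ⟨
    countBelow (q * K + n % K) f         ≡⟨ cong (λ z → countBelow z f) n≡ ⟩
    countBelow n f                       ∎
    where
    open ≤-Reasoning
    q = n / K
    f = h ∘ (_% K)
    n≡ : q * K + n % K ≡ n
    n≡ = trans (+-comm _ (n % K)) (sym (m≡m%n+[m/n]*n n K))

  countBelow≤n∸n/K : ∀ n h → 1 ≤ countBelow K (not ∘ h) → countBelow n (h ∘ (_% K)) ≤ n ∸ n / K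
  countBelow≤n∸n/K n h 1≤ = begin
    hits                     ≡⟨ m+n∸n≡m hits misses ⟨
    hits + misses ∸ misses   ≡⟨ cong (_∸ misses) (countBelow-not n (h ∘ (_% K))) ⟩
    n ∸ misses               ≤⟨ ∸-monoʳ-≤ n (n/K≤countBelow n (not ∘ h) 1≤) ⟩
    n ∸ n / K                ∎
    where
    open ≤-Reasoning
    hits = countBelow n (h ∘ (_% K))
    misses = countBelow n (not ∘ h ∘ (_% K))

module PeriodicColouring {r} (K : ℕ) .{{_ : NonZero K}} (types : ℕ → Subset r)
  (pairwise : T (allBelow K λ i → allBelow K λ j → meets (types i) (types j))) where

  typeOf : ∀ {n} → Fin n → Subset r
  typeOf v = types (toℕ v % K)

  typeOf-meets : ∀ {n} (u v : Fin n) → T (meets (typeOf u) (typeOf v))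
  typeOf-meets u v =
    allBelow-sound K (allBelow-sound K pairwise (m%n<n (toℕ u) K)) (m%n<n (toℕ v) K)

  colouring : ∀ n → Colouring n r
  colouring n = (λ u v → firstCommon (typeOf u) (typeOf v) (typeOf-meets u v)) ,
                (λ u v → firstCommon-comm (typeOf u) (typeOf v) _ _)

  coveredTypes : ℕ → Subset r → ℕ
  coveredTypes n S = countBelow n (λ i → meets (types (i % K)) S)

  GoodBound⇒coveredTypes : ∀ {n s m} → GoodBound n r s m →
                           ∃ λ S → ∣ S ∣ ≤ s × m ≤ coveredTypes n S
  GoodBound⇒coveredTypes {n} good with good (colouring n)
  ... | S , ∣S∣≤s , V , m≤∣V∣ , incident = S , ∣S∣≤s , (begin
    _                                       ≤⟨ m≤∣V∣ ⟩
    ∣ V ∣                                   ≤⟨ ∣p∣≤count V (λ v → meets (typeOf v) S) covered ⟩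
    count {n} (λ v → meets (typeOf v) S)    ≡⟨ count-toℕ {n} (λ i → meets (types (i % K)) S) ⟩
    coveredTypes n S                        ∎)
    where
    open ≤-Reasoning
    covered : ∀ {v} → v ∈ V → T (meets (typeOf v) S)
    covered v∈V with incident _ v∈V
    ... | u , _ , colour∈S = meets-intro (firstCommon∈ˡ _ _ _) colour∈S

  open Cyclic K

  divisible-upper : ∀ s m₀ → T (forSmall r s λ S → countBelow K (λ j → meets (types j) S) ≤ᵇ m₀) →
                    ∀ k {m} → GoodBound (K * k) r s m → m ≤ m₀ * k
  divisible-upper s m₀ check k good with GoodBound⇒coveredTypes good
  ... | S , ∣S∣≤s , m≤ = begin
    _                         ≤⟨ m≤ ⟩
    coveredTypes (K * k) S    ≡⟨ cong (λ z → coveredTypes z S) (*-comm K k) ⟩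
    coveredTypes (k * K) S    ≡⟨ countBelow-periodic k meetsS ⟩
    k * countBelow K meetsS   ≤⟨ *-monoʳ-≤ k (≤ᵇ⇒≤ _ _ (forSmall-sound r s check S ∣S∣≤s)) ⟩
    k * m₀                    ≡⟨ *-comm k m₀ ⟩
    m₀ * k                    ∎
    where
    open ≤-Reasoning
    meetsS = λ j → meets (types j) S

  missing-upper : ∀ s → T (forSmall r s λ S → 1 ≤ᵇ countBelow K (λ j → not (meets (types j) S))) →
                  ∀ n {m} → GoodBound n r s m → m ≤ n ∸ n / K
  missing-upper s check n good with GoodBound⇒coveredTypes good
  ... | S , ∣S∣≤s , m≤ = ≤-trans m≤ (countBelow≤n∸n/K n (λ j → meets (types j) S) some-type-missed)
    where some-type-missed = ≤ᵇ⇒≤ 1 _ (forSmall-sound r s check S ∣S∣≤s)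

n∸n/K≤ceilFrac : ∀ c n → n ∸ n / suc c ≤ ceilFrac c c n
n∸n/K≤ceilFrac c n = subst (_≤ ceilFrac c c n) (m*n/n≡m (n ∸ n / K) K) (/-monoˡ-≤ K (begin
  (n ∸ n / K) * K           ≡⟨ *-distribʳ-∸ K n (n / K) ⟩
  n * K ∸ n / K * K         ≤⟨ m≤n+o⇒m∸n≤o (n * K) (n / K * K) n*K≤ ⟩
  c * n + c                 ∎))
  where
  open ≤-Reasoning
  K = suc c
  n%K≤c : n % K ≤ c
  n%K≤c = s≤s⁻¹ (m%n<n n K)
  n*K≤ : n * K ≤ n / K * K + (c * n + c)
  n*K≤ = begin
    n * K                             ≡⟨ *-suc n c ⟩
    n + n * c                         ≡⟨ cong (_+ n * c) (m≡m%n+[m/n]*n n K) ⟩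
    n % K + n / K * K + n * c         ≤⟨ +-monoˡ-≤ (n * c) (+-monoˡ-≤ (n / K * K) n%K≤c) ⟩
    c + n / K * K + n * c             ≡⟨ cong (λ z → c + n / K * K + z) (*-comm n c) ⟩
    c + n / K * K + c * n             ≡⟨ solve 3 (λ c q cn → c :+ q :+ cn := q :+ (cn :+ c))
                                                 refl c (n / K * K) (c * n) ⟩
    n / K * K + (c * n + c)           ∎

GoodBound⇒≤n : ∀ {n r s m} → GoodBound n (suc r) s m → m ≤ n
GoodBound⇒≤n good with good ((λ _ _ → zero) , λ _ _ → refl)
... | _ , _ , V , m≤∣V∣ , _ = ≤-trans m≤∣V∣ (∣p∣≤n V)

GoodBound-monoˢ : ∀ {n r s s′ m} → s ≤ s′ → GoodBound n r s m → GoodBound n r s′ m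
GoodBound-monoˢ s≤s′ good c with good c
... | S , ∣S∣≤s , cover = S , ≤-trans ∣S∣≤s s≤s′ , cover

2≤K*k : ∀ K k → 2 ≤ K → 1 ≤ k → 2 ≤ K * k
2≤K*k K k 2≤K 1≤k = ≤-trans 2≤K (≤-trans (≤-reflexive (sym (*-identityʳ K))) (*-monoʳ-≤ K 1≤k))

divisible-lower : ∀ {r s} K m₀ W α .{{_ : NonZero W}} (σ : Strategy r) fuel →
                  T (CoveringGame.wins s W α σ fuel []) → 0 < α → 2 ≤ K → m₀ * W ≡ α * K →
                  ∀ k → 1 ≤ k → GoodBound (K * k) r s (m₀ * k)
divisible-lower K m₀ W α σ fuel w 0<α 2≤K m₀*W≡α*K k 1≤k =
  winning⇒GoodBound σ fuel w 0<α (2≤K*k K k 2≤K 1≤k) (≤⌈⌉-scaled m₀ α K W m₀*W≡α*K k)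

full-lower : ∀ {r s} s₀ (σ : Strategy r) fuel → T (CoveringGame.wins s₀ 1 1 σ fuel []) → s₀ ≤ s →
             ∀ n → 2 ≤ n → GoodBound n r s n
full-lower s₀ σ fuel w s₀≤s n 2≤n =
  GoodBound-monoˢ s₀≤s (winning⇒GoodBound σ fuel w (s≤s z≤n) 2≤n (≤⌈⌉-exact (*-comm n 1)))

-- `mask r d` reads the decimal digits of d, padded with leading zeros to length r, as the
-- membership bits of colours 0, …, r - 1; so `mask 5 01101` is {1, 2, 4}.
mask : ∀ r → ℕ → Subset r
mask zero _ = []
mask (suc r) d = mask r (d / 10) ∷ʳ (d % 10 ≡ᵇ 1)

subsetsOfSize : ∀ r → ℕ → List (Subset r)
subsetsOfSize zero zero = [] ∷ []
subsetsOfSize zero (suc k) = []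
subsetsOfSize (suc r) zero = List.map (outside ∷_) (subsetsOfSize r zero)
subsetsOfSize (suc r) (suc k) =
  List.map (inside ∷_) (subsetsOfSize r k) List.++ List.map (outside ∷_) (subsetsOfSize r (suc k))

entry : ∀ {r} → List (Subset r) → ℕ → Subset r
entry [] _ = ∅
entry (A ∷ _) zero = A
entry (_ ∷ As) (suc i) = entry As i

onColours : ∀ {r} → Vec ℕ r → Weighting r
onColours ws = toList (tabulate (λ i → lookup ws i , ⁅ i ⁆))

-- Every later vertex colour set meets the first revealed one, A, so weight concentrated on A
-- (or spread over its colours) serves all of them.
uniformThenThreat : ∀ {r} → List (Subset r) → Strategy r
uniformThenThreat F [] = List.map (1 ,_) F
uniformThenThreat F (A ∷ _) = (length F , A) ∷ []

coloursThenThreat : ∀ {r} → ℕ → Strategy r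
coloursThenThreat α [] = onColours (replicate _ 1)
coloursThenThreat α (A ∷ _) = onColours (map (λ a → if a then α else 0) A)

firstElement : ∀ {r} → Subset r → Subset r
firstElement [] = []
firstElement (true ∷ A) = true ∷ ∅
firstElement (false ∷ A) = false ∷ firstElement A

starWeights : ℕ → ℕ × ℕ × ℕ
starWeights 1 = 150 , 150 , 80
starWeights 2 = 180 , 120 , 60
starWeights 3 = 200 , 100 , 40
starWeights _ = 240 , 75 , 0

star : Subset 5 → Subset 5 → Weighting 5
star centre leaves with starWeights ∣ leaves ∣
... | wc , wl , wo =
  onColours (zipWith (λ c l → if c then wc else if l then wl else wo) centre leaves)

-- A revealed singleton is met by every vertex colour set. Otherwise the revealed sets of size 2
-- are pairwise intersecting, so they either form a triangle or share a centre colour (a star).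
strategy51 : Strategy 5
strategy51 seen with filterᵇ (λ A → ∣ A ∣ ≡ᵇ 1) seen | filterᵇ (λ A → ∣ A ∣ ≡ᵇ 2) seen
... | A ∷ _ | _ = (540 , A) ∷ []
... | [] | [] = onColours (replicate 5 108)
... | [] | pairs@(_ ∷ _) with ∣ ⋂ pairs ∣
...   | zero = onColours (map (λ a → if a then 180 else 0) (⋃ pairs))
...   | suc _ = star (firstElement (⋂ pairs)) (⋃ pairs ─ firstElement (⋂ pairs))

types51 : List (Subset 5)
types51 = List.map (mask 5) (11000 ∷ 10100 ∷ 10011 ∷ 10011 ∷ 10011 ∷ 01110 ∷ 01110 ∷ 01101 ∷ 01101 ∷ [])

types61 types62 : List (Subset 6)
types61 = List.map (mask 6) (111000 ∷ 100110 ∷ 010101 ∷ 001011 ∷ [])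
types62 = List.map (mask 6)
  (000111 ∷ 001011 ∷ 110010 ∷ 110001 ∷ 101100 ∷ 010101 ∷ 101001 ∷ 100110 ∷ 011010 ∷ 011100 ∷ [])

fanoLines : List (Subset 7)
fanoLines = List.map (mask 7)
  (1110000 ∷ 1001100 ∷ 1000011 ∷ 0101010 ∷ 0100101 ∷ 0011001 ∷ 0010110 ∷ [])

open PeriodicColouring using (divisible-upper; missing-upper)

g[5,1] : ∀ k → 1 ≤ k → IsG (9 * k) 5 1 (5 * k)
g[5,1] k 1≤k =
  divisible-lower 9 5 540 300 strategy51 12 _ (s≤s z≤n) (s≤s (s≤s z≤n)) refl k 1≤k ,
  λ _ → divisible-upper 9 (entry types51) _ 1 5 _ k

g[5,2] : ∀ n → 2 ≤ n → IsG n 5 2 (ceilFrac 9 9 n)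
g[5,2] n 2≤n =
  winning⇒GoodBound {W = 10} {α = 9} (uniformThenThreat (subsetsOfSize 5 2)) 2 _ (s≤s z≤n) 2≤n
                    (ceilFrac-≤⌈⌉ 9 9 n) ,
  λ _ good → ≤-trans (missing-upper 10 (entry (subsetsOfSize 5 3)) _ 2 _ n good) (n∸n/K≤ceilFrac 9 n)

g[5,s] : ∀ n s → 2 ≤ n → 3 ≤ s → IsG n 5 s n
g[5,s] n s 2≤n 3≤s =
  full-lower 3 (uniformThenThreat (mask 5 11100 ∷ [])) 2 _ 3≤s n 2≤n , λ _ → GoodBound⇒≤n

g[6,1] : ∀ k → 1 ≤ k → IsG (4 * k) 6 1 (2 * k)
g[6,1] k 1≤k =
  divisible-lower 4 2 6 3 (coloursThenThreat 3) 2 _ (s≤s z≤n) (s≤s (s≤s z≤n)) refl k 1≤k ,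
  λ _ → divisible-upper 4 (entry types61) _ 1 2 _ k

g[6,2] : ∀ k → 1 ≤ k → IsG (10 * k) 6 2 (8 * k)
g[6,2] k 1≤k =
  divisible-lower 10 8 15 12 (uniformThenThreat (subsetsOfSize 6 2)) 2 _
                  (s≤s z≤n) (s≤s (s≤s z≤n)) refl k 1≤k ,
  λ _ → divisible-upper 10 (entry types62) _ 2 8 _ k

g[6,s] : ∀ n s → 2 ≤ n → 3 ≤ s → IsG n 6 s n
g[6,s] n s 2≤n 3≤s =
  full-lower 3 (uniformThenThreat (mask 6 111000 ∷ [])) 2 _ 3≤s n 2≤n , λ _ → GoodBound⇒≤n

g[7,1] : ∀ k → 1 ≤ k → IsG (7 * k) 7 1 (3 * k)
g[7,1] k 1≤k =
  divisible-lower 7 3 7 3 (coloursThenThreat 3) 2 _ (s≤s z≤n) (s≤s (s≤s z≤n)) refl k 1≤k ,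
  λ _ → divisible-upper 7 (entry fanoLines) _ 1 3 _ k

g[7,2] : ∀ k → 1 ≤ k → IsG (7 * k) 7 2 (5 * k)
g[7,2] k 1≤k =
  divisible-lower 7 5 21 15 (uniformThenThreat (subsetsOfSize 7 2)) 2 _
                  (s≤s z≤n) (s≤s (s≤s z≤n)) refl k 1≤k ,
  λ _ → divisible-upper 7 (entry fanoLines) _ 2 5 _ k

g[7,3] : ∀ n → 2 ≤ n → IsG n 7 3 (ceilFrac 34 34 n)
g[7,3] n 2≤n =
  winning⇒GoodBound {W = 35} {α = 34} (uniformThenThreat (subsetsOfSize 7 3)) 2 _ (s≤s z≤n) 2≤n
                    (ceilFrac-≤⌈⌉ 34 34 n) ,
  λ _ good → ≤-trans (missing-upper 35 (entry (subsetsOfSize 7 4)) _ 3 _ n good) (n∸n/K≤ceilFrac 34 n)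

g[7,s] : ∀ n s → 2 ≤ n → 3 < s → IsG n 7 s n
g[7,s] n s 2≤n 3<s =
  full-lower 4 (uniformThenThreat (mask 7 1111000 ∷ [])) 2 _ 3<s n 2≤n , λ _ → GoodBound⇒≤n

theorem2p12 :
    (∀ k → 1 ≤ k → IsG (9 * k) 5 1 (5 * k)) ×
    (∀ n → 2 ≤ n → IsG n 5 2 (ceilFrac 9 9 n)) ×
    (∀ n s → 2 ≤ n → 3 ≤ s → IsG n 5 s n) ×
    (∀ k → 1 ≤ k → IsG (4 * k) 6 1 (2 * k)) ×
    (∀ k → 1 ≤ k → IsG (10 * k) 6 2 (8 * k)) ×
    (∀ n s → 2 ≤ n → 3 ≤ s → IsG n 6 s n) ×
    (∀ k → 1 ≤ k → IsG (7 * k) 7 1 (3 * k)) ×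
    (∀ k → 1 ≤ k → IsG (7 * k) 7 2 (5 * k)) ×
    (∀ n → 2 ≤ n → IsG n 7 3 (ceilFrac 34 34 n)) ×
    (∀ n s → 2 ≤ n → 3 < s → IsG n 7 s n)
theorem2p12 =
  g[5,1] , g[5,2] , g[5,s] , g[6,1] , g[6,2] , g[6,s] , g[7,1] , g[7,2] , g[7,3] , g[7,s]
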